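{- Let $\mathbf L=(L,\vee,\wedge,0,1)$ be a complemented lattice and $a\in L$. Then: (i) $a\in a^{++}$ and $a^{+++}=a^+$; (ii) $(x^+,\le)$ is an antichain for every $x\in L$ if and only if $\mathbf L$ does not contain a sublattice isomorphic to $\mathbf N_5$ which contains $0$ and $1$; (iii) $(a^+,\le)$ is convex, i.e. if $b,c\in a^+$, $d\in L$ and $b\le d\le c$, then $d\in a^+$; (iv) if the mapping $x\mapsto x^{++}$ from $L$ to $2^L$ is not injective, then $\mathbf L$ does not satisfy the identity $x^{++}\approx x$ (i.e. there is some $x\in L$ with $x^{++}\neq\{x\}$).
   Context: A bounded lattice $(L,\vee,\wedge,0,1)$ is complemented if every element has a complement, where $b$ is a complement of $a$ if $a\vee b=1$ and $a\wedge b=0$; complements need not be unique, and lattices are assumed non-trivial ($0\neq1$). For $A\subseteq L$ put $A^+:=\{x\in L\mid a\vee x=1\text{ and }a\wedge x=0\text{ for all }a\in A\}$, and for $a\in L$ put $a^+:=\{a\}^+$, the set of all complements of $a$. Singletons are identified with their elements, so $a^{++}=(a^+)^+$ etc. $\mathbf N_5$ is the five-element non-modular lattice $\{0,e,f,g,1\}$ with $0<e<f<1$, $0<g<1$ and $g$ incomparable with $e,f$. -}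

module Defs where

open import Level using (Level; _⊔_)
open import Data.Product using (Σ; _×_; _,_)
open import Relation.Nullary using (¬_)
open import Relation.Unary using (Pred)
open import Relation.Binary.PropositionalEquality using (_≡_)
open import Relation.Binary.Lattice.Bundles using (BoundedLattice)

-- The five-element non-modular lattice N5 = {0,e,f,g,1}:
-- 0 < e < f < 1, 0 < g < 1, g incomparable with e and f.
data N5 : Set where
  n0 ne nf ng n1 : N5

_∨₅_ : N5 → N5 → N5
n0 ∨₅ y  = y
x  ∨₅ n0 = x
n1 ∨₅ y  = n1
x  ∨₅ n1 = n1
ne ∨₅ ne = ne
ne ∨₅ nf = nf
ne ∨₅ ng = n1
nf ∨₅ ne = nf
nf ∨₅ nf = nf
nf ∨₅ ng = n1
ng ∨₅ ne = n1
ng ∨₅ nf = n1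
ng ∨₅ ng = ng

_∧₅_ : N5 → N5 → N5
n0 ∧₅ y  = n0
x  ∧₅ n0 = n0
n1 ∧₅ y  = y
x  ∧₅ n1 = x
ne ∧₅ ne = ne
ne ∧₅ nf = ne
ne ∧₅ ng = n0
nf ∧₅ ne = ne
nf ∧₅ nf = nf
nf ∧₅ ng = n0
ng ∧₅ ne = n0
ng ∧₅ nf = n0
ng ∧₅ ng = ng

module Ops {c ℓ₁ ℓ₂ : Level} (L : BoundedLattice c ℓ₁ ℓ₂) where
  open BoundedLattice L

  IsComplement : Carrier → Carrier → Set ℓ₁
  IsComplement a b = ((a ∨ b) ≈ ⊤) × ((a ∧ b) ≈ ⊥)

  Complemented : Set (c ⊔ ℓ₁)
  Complemented = ∀ a → Σ Carrier (λ b → IsComplement a b)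

  _⁺ : {p : Level} → Pred Carrier p → Pred Carrier (c ⊔ p ⊔ ℓ₁)
  (A ⁺) x = ∀ a → A a → IsComplement a x

  ｛_｝ : Carrier → Pred Carrier ℓ₁
  ｛ a ｝ x = x ≈ a

  _⁺ᵉ : Carrier → Pred Carrier (c ⊔ ℓ₁)
  a ⁺ᵉ = ｛ a ｝ ⁺

  _≐_ : {p q : Level} → Pred Carrier p → Pred Carrier q → Set (c ⊔ p ⊔ q)
  A ≐ B = (∀ x → A x → B x) × (∀ x → B x → A x)

  Antichain : {p : Level} → Pred Carrier p → Set (c ⊔ p ⊔ ℓ₁ ⊔ ℓ₂)
  Antichain A = ∀ x y → A x → A y → ¬ (x ≈ y) → ¬ (x ≤ y)

  Convex : {p : Level} → Pred Carrier p → Set (c ⊔ p ⊔ ℓ₂)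
  Convex A = ∀ b c d → A b → A c → b ≤ d → d ≤ c → A d

  -- h is a lattice embedding of N5 into L (its image is a sublattice isomorphic to N5)
  IsN5Embedding : (N5 → Carrier) → Set ℓ₁
  IsN5Embedding h =
    (∀ x y → h (x ∨₅ y) ≈ (h x ∨ h y)) ×
    (∀ x y → h (x ∧₅ y) ≈ (h x ∧ h y)) ×
    (∀ x y → h x ≈ h y → x ≡ y)

  HasN5With01 : Set (c ⊔ ℓ₁)
  HasN5With01 = Σ (N5 → Carrier) λ h → IsN5Embedding h ×
    Σ N5 (λ u → h u ≈ ⊥) × Σ N5 (λ v → h v ≈ ⊤)

  PlusPlusInjective : Set (c ⊔ ℓ₁)
  PlusPlusInjective = ∀ x y → ((x ⁺ᵉ) ⁺) ≐ ((y ⁺ᵉ) ⁺) → x ≈ y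

  SatisfiesPlusPlusId : Set (c ⊔ ℓ₁)
  SatisfiesPlusPlusId = ∀ x → ((x ⁺ᵉ) ⁺) ≐ ｛ x ｝

-- Apart from (ii), everything is formal: "is a complement of" is a symmetric relation, so A ↦ A⁺
-- is the antitone Galois connection it induces (whence A ⊆ A⁺⁺ and A⁺⁺⁺ = A⁺), and x ∨ _ ≈ ⊤ is
-- upward closed while x ∧ _ ≈ ⊥ is downward closed, so the complements of x form a convex set.
-- For (ii), the images of e < f in a copy of N5 through 0 and 1 are distinct comparable
-- complements of the image of g; conversely two distinct complements b < c of x span the
-- pentagon 0 < b < c < 1, 0 < x < 1.
module Submission where

open import Defs
open import Level using (Level)
open import Data.Product using (_×_; _,_; proj₁; proj₂)
open import Data.Empty using (⊥-elim)
open import Relation.Nullary using (¬_)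
open import Relation.Unary using (Pred; _⊆_)
open import Function.Bundles using (_⇔_; mk⇔)
open import Relation.Binary.Lattice.Bundles using (BoundedLattice)
open import Relation.Binary.PropositionalEquality using (_≡_; refl; cong)
import Relation.Binary.Lattice.Properties.JoinSemilattice as JoinSemilatticeProperties
import Relation.Binary.Lattice.Properties.MeetSemilattice as MeetSemilatticeProperties
import Relation.Binary.Lattice.Properties.BoundedJoinSemilattice as BoundedJoinSemilatticeProperties
import Relation.Binary.Lattice.Properties.BoundedMeetSemilattice as BoundedMeetSemilatticeProperties
import Relation.Binary.Lattice.Properties.BoundedLattice as BoundedLatticeProperties
import Relation.Binary.Reasoning.PartialOrder as PosetReasoning
import Relation.Binary.Reasoning.Setoid as SetoidReasoning

n1∨₅x≡n1 : ∀ x → n1 ∨₅ x ≡ n1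
n1∨₅x≡n1 n0 = refl
n1∨₅x≡n1 ne = refl
n1∨₅x≡n1 nf = refl
n1∨₅x≡n1 ng = refl
n1∨₅x≡n1 n1 = refl

module Complements {c ℓ₁ ℓ₂ : Level} (L : BoundedLattice c ℓ₁ ℓ₂) where
  open BoundedLattice L renaming (refl to ≤-refl)
  open Ops L
  open JoinSemilatticeProperties joinSemilattice
  open MeetSemilatticeProperties meetSemilattice
  open BoundedJoinSemilatticeProperties boundedJoinSemilattice
    renaming (identityˡ to ∨-identityˡ; identityʳ to ∨-identityʳ)
  open BoundedJoinSemilatticeProperties
    (BoundedMeetSemilatticeProperties.dualBoundedJoinSemilattice boundedMeetSemilattice)
    renaming (identityˡ to ∧-identityˡ; identityʳ to ∧-identityʳ)
  open BoundedLatticeProperties L using (∨-zeroˡ; ∨-zeroʳ; ∧-zeroˡ; ∧-zeroʳ)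

  private
    variable
      ℓ ℓ′ : Level
      x y z : Carrier

  IsComplement-sym : IsComplement x y → IsComplement y x
  IsComplement-sym (x∨y≈⊤ , x∧y≈⊥) =
    Eq.trans (∨-comm _ _) x∨y≈⊤ , Eq.trans (∧-comm _ _) x∧y≈⊥

  ⁺-antitone : {A : Pred Carrier ℓ} {B : Pred Carrier ℓ′} → A ⊆ B → (B ⁺) ⊆ (A ⁺)
  ⁺-antitone A⊆B x∈B⁺ a a∈A = x∈B⁺ a (A⊆B a∈A)

  ⊆⁺⁺ : {A : Pred Carrier ℓ} → A ⊆ ((A ⁺) ⁺)
  ⊆⁺⁺ a∈A y y∈A⁺ = IsComplement-sym (y∈A⁺ _ a∈A)

  ⁺⁺⁺≐⁺ : (A : Pred Carrier ℓ) → (((A ⁺) ⁺) ⁺) ≐ (A ⁺)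
  ⁺⁺⁺≐⁺ A = (λ _ → ⁺-antitone (⊆⁺⁺ {A = A})) , (λ _ → ⊆⁺⁺)

  ∨≈⊤-monoʳ : x ∨ y ≈ ⊤ → y ≤ z → x ∨ z ≈ ⊤
  ∨≈⊤-monoʳ x∨y≈⊤ y≤z =
    antisym (maximum _) (trans (reflexive (Eq.sym x∨y≈⊤)) (∨-monotonic ≤-refl y≤z))

  ∧≈⊥-antiʳ : x ∧ z ≈ ⊥ → y ≤ z → x ∧ y ≈ ⊥
  ∧≈⊥-antiʳ x∧z≈⊥ y≤z =
    antisym (trans (∧-monotonic ≤-refl y≤z) (reflexive x∧z≈⊥)) (minimum _)

  x∧y≈⊥⇒x≈⊤⇒y≈⊥ : x ∧ y ≈ ⊥ → x ≈ ⊤ → y ≈ ⊥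
  x∧y≈⊥⇒x≈⊤⇒y≈⊥ {x} {y} x∧y≈⊥ x≈⊤ = begin
    y        ≈⟨ ∧-identityˡ y ⟨
    ⊤ ∧ y    ≈⟨ ∧-cong x≈⊤ Eq.refl ⟨
    x ∧ y    ≈⟨ x∧y≈⊥ ⟩
    ⊥        ∎
    where open SetoidReasoning setoid

  x∨y≈⊤⇒x≈⊥⇒y≈⊤ : x ∨ y ≈ ⊤ → x ≈ ⊥ → y ≈ ⊤
  x∨y≈⊤⇒x≈⊥⇒y≈⊤ {x} {y} x∨y≈⊤ x≈⊥ = begin
    y        ≈⟨ ∨-identityˡ y ⟨
    ⊥ ∨ y    ≈⟨ ∨-cong x≈⊥ Eq.refl ⟨
    x ∨ y    ≈⟨ x∨y≈⊤ ⟩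
    ⊤        ∎
    where open SetoidReasoning setoid

  ⁺ᵉ-convex : ∀ a → Convex (a ⁺ᵉ)
  ⁺ᵉ-convex a b c d b∈a⁺ c∈a⁺ b≤d d≤c a′ a′≈a =
    ∨≈⊤-monoʳ (proj₁ (b∈a⁺ a′ a′≈a)) b≤d ,
    ∧≈⊥-antiʳ (proj₂ (c∈a⁺ a′ a′≈a)) d≤c

  plusPlusId⇒plusPlusInjective : SatisfiesPlusPlusId → PlusPlusInjective
  plusPlusId⇒plusPlusInjective x⁺⁺≐x x y (x⁺⁺⊆y⁺⁺ , _) =
    proj₁ (x⁺⁺≐x y) x (x⁺⁺⊆y⁺⁺ x (proj₂ (x⁺⁺≐x x) x Eq.refl))

  module _ {h : N5 → Carrier} (h-embedding : IsN5Embedding h) where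
    private
      h-∨ : ∀ p q → h (p ∨₅ q) ≈ h p ∨ h q
      h-∨ = proj₁ h-embedding

      h-∧ : ∀ p q → h (p ∧₅ q) ≈ h p ∧ h q
      h-∧ = proj₁ (proj₂ h-embedding)

    h-n0≈⊥ : ∀ u → h u ≈ ⊥ → h n0 ≈ ⊥
    h-n0≈⊥ u hu≈⊥ = antisym h-n0≤⊥ (minimum _)
      where
      open PosetReasoning poset
      h-n0≤⊥ : h n0 ≤ ⊥
      h-n0≤⊥ = begin
        h n0         ≈⟨ h-∧ n0 u ⟩
        h n0 ∧ h u   ≤⟨ x∧y≤y _ _ ⟩
        h u          ≈⟨ hu≈⊥ ⟩
        ⊥            ∎

    h-n1≈⊤ : ∀ v → h v ≈ ⊤ → h n1 ≈ ⊤
    h-n1≈⊤ v hv≈⊤ = antisym (maximum _) ⊤≤h-n1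
      where
      open PosetReasoning poset
      ⊤≤h-n1 : ⊤ ≤ h n1
      ⊤≤h-n1 = begin
        ⊤              ≈⟨ hv≈⊤ ⟨
        h v            ≤⟨ y≤x∨y _ _ ⟩
        h n1 ∨ h v     ≈⟨ h-∨ n1 v ⟨
        h (n1 ∨₅ v)    ≡⟨ cong h (n1∨₅x≡n1 v) ⟩
        h n1           ∎

    h-monotone : ∀ p q → p ∧₅ q ≡ p → h p ≤ h q
    h-monotone p q p∧q≡p = begin
      h p           ≡⟨ cong h p∧q≡p ⟨
      h (p ∧₅ q)    ≈⟨ h-∧ p q ⟩
      h p ∧ h q     ≤⟨ x∧y≤y _ _ ⟩
      h q           ∎
      where open PosetReasoning poset

    h-complement : h n0 ≈ ⊥ → h n1 ≈ ⊤ →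
                   ∀ p q → p ∨₅ q ≡ n1 → p ∧₅ q ≡ n0 → (h p ⁺ᵉ) (h q)
    h-complement h-n0≈⊥ h-n1≈⊤ p q p∨q≡n1 p∧q≡n0 a a≈hp =
      Eq.trans (∨-cong a≈hp Eq.refl) (Eq.trans (Eq.sym (h-∨ p q))
        (Eq.trans (Eq.reflexive (cong h p∨q≡n1)) h-n1≈⊤)) ,
      Eq.trans (∧-cong a≈hp Eq.refl) (Eq.trans (Eq.sym (h-∧ p q))
        (Eq.trans (Eq.reflexive (cong h p∧q≡n0)) h-n0≈⊥))

  antichain⇒¬HasN5With01 : (∀ x → Antichain (x ⁺ᵉ)) → ¬ HasN5With01
  antichain⇒¬HasN5With01 antichain
    (h , h-embedding@(_ , _ , h-injective) , (u , hu≈⊥) , (v , hv≈⊤)) =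
    antichain (h ng) (h ne) (h nf) (complement ne refl refl) (complement nf refl refl)
      (λ he≈hf → ne≢nf (h-injective ne nf he≈hf)) (h-monotone h-embedding ne nf refl)
    where
    ne≢nf : ¬ ne ≡ nf
    ne≢nf ()

    complement : ∀ q → ng ∨₅ q ≡ n1 → ng ∧₅ q ≡ n0 → (h ng ⁺ᵉ) (h q)
    complement =
      h-complement h-embedding (h-n0≈⊥ h-embedding u hu≈⊥) (h-n1≈⊤ h-embedding v hv≈⊤) ng

  module Pentagon {x b c : Carrier}
                  (x∨b≈⊤ : x ∨ b ≈ ⊤) (x∧c≈⊥ : x ∧ c ≈ ⊥) (b≤c : b ≤ c) where
    x∨c≈⊤ : x ∨ c ≈ ⊤
    x∨c≈⊤ = ∨≈⊤-monoʳ x∨b≈⊤ b≤c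

    x∧b≈⊥ : x ∧ b ≈ ⊥
    x∧b≈⊥ = ∧≈⊥-antiʳ x∧c≈⊥ b≤c

    pentagon : N5 → Carrier
    pentagon n0 = ⊥
    pentagon ne = b
    pentagon nf = c
    pentagon ng = x
    pentagon n1 = ⊤

    pentagon-∨ : ∀ p q → pentagon p ∨ pentagon q ≈ pentagon (p ∨₅ q)
    pentagon-∨ n0 q  = ∨-identityˡ _
    pentagon-∨ ne n0 = ∨-identityʳ _
    pentagon-∨ nf n0 = ∨-identityʳ _
    pentagon-∨ ng n0 = ∨-identityʳ _
    pentagon-∨ n1 n0 = ∨-identityʳ _
    pentagon-∨ n1 ne = ∨-zeroˡ _
    pentagon-∨ n1 nf = ∨-zeroˡ _
    pentagon-∨ n1 ng = ∨-zeroˡ _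
    pentagon-∨ n1 n1 = ∨-zeroˡ _
    pentagon-∨ ne n1 = ∨-zeroʳ _
    pentagon-∨ nf n1 = ∨-zeroʳ _
    pentagon-∨ ng n1 = ∨-zeroʳ _
    pentagon-∨ ne ne = ∨-idempotent _
    pentagon-∨ ne nf = x≤y⇒x∨y≈y b≤c
    pentagon-∨ ne ng = Eq.trans (∨-comm b x) x∨b≈⊤
    pentagon-∨ nf ne = Eq.trans (∨-comm c b) (x≤y⇒x∨y≈y b≤c)
    pentagon-∨ nf nf = ∨-idempotent _
    pentagon-∨ nf ng = Eq.trans (∨-comm c x) x∨c≈⊤
    pentagon-∨ ng ne = x∨b≈⊤
    pentagon-∨ ng nf = x∨c≈⊤
    pentagon-∨ ng ng = ∨-idempotent _

    pentagon-∧ : ∀ p q → pentagon p ∧ pentagon q ≈ pentagon (p ∧₅ q)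
    pentagon-∧ n0 q  = ∧-zeroˡ _
    pentagon-∧ ne n0 = ∧-zeroʳ _
    pentagon-∧ nf n0 = ∧-zeroʳ _
    pentagon-∧ ng n0 = ∧-zeroʳ _
    pentagon-∧ n1 n0 = ∧-zeroʳ _
    pentagon-∧ n1 ne = ∧-identityˡ _
    pentagon-∧ n1 nf = ∧-identityˡ _
    pentagon-∧ n1 ng = ∧-identityˡ _
    pentagon-∧ n1 n1 = ∧-identityˡ _
    pentagon-∧ ne n1 = ∧-identityʳ _
    pentagon-∧ nf n1 = ∧-identityʳ _
    pentagon-∧ ng n1 = ∧-identityʳ _
    pentagon-∧ ne ne = ∧-idempotent _
    pentagon-∧ ne nf = Eq.trans (∧-comm b c) (y≤x⇒x∧y≈y b≤c)
    pentagon-∧ ne ng = Eq.trans (∧-comm b x) x∧b≈⊥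
    pentagon-∧ nf ne = y≤x⇒x∧y≈y b≤c
    pentagon-∧ nf nf = ∧-idempotent _
    pentagon-∧ nf ng = Eq.trans (∧-comm c x) x∧c≈⊥
    pentagon-∧ ng ne = x∧b≈⊥
    pentagon-∧ ng nf = x∧c≈⊥
    pentagon-∧ ng ng = ∧-idempotent _

    -- Every proper quotient of N5 identifies e and f, so each coincidence of two vertices of the
    -- pentagon forces b ≈ c.
    x≈⊥⇒b≈c : x ≈ ⊥ → b ≈ c
    x≈⊥⇒b≈c x≈⊥ =
      Eq.trans (x∨y≈⊤⇒x≈⊥⇒y≈⊤ x∨b≈⊤ x≈⊥) (Eq.sym (x∨y≈⊤⇒x≈⊥⇒y≈⊤ x∨c≈⊤ x≈⊥))

    x≈⊤⇒b≈c : x ≈ ⊤ → b ≈ c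
    x≈⊤⇒b≈c x≈⊤ =
      Eq.trans (x∧y≈⊥⇒x≈⊤⇒y≈⊥ x∧b≈⊥ x≈⊤) (Eq.sym (x∧y≈⊥⇒x≈⊤⇒y≈⊥ x∧c≈⊥ x≈⊤))

    ⊥≈⊤⇒b≈c : ⊥ ≈ ⊤ → b ≈ c
    ⊥≈⊤⇒b≈c ⊥≈⊤ =
      x≈⊤⇒b≈c (antisym (maximum x) (trans (reflexive (Eq.sym ⊥≈⊤)) (minimum x)))

    b≈⊥⇒b≈c : b ≈ ⊥ → b ≈ c
    b≈⊥⇒b≈c b≈⊥ = x≈⊤⇒b≈c (x∨y≈⊤⇒x≈⊥⇒y≈⊤ (Eq.trans (∨-comm b x) x∨b≈⊤) b≈⊥)

    c≈⊤⇒b≈c : c ≈ ⊤ → b ≈ c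
    c≈⊤⇒b≈c c≈⊤ = x≈⊥⇒b≈c (x∧y≈⊥⇒x≈⊤⇒y≈⊥ (Eq.trans (∧-comm c x) x∧c≈⊥) c≈⊤)

    b≈⊤⇒b≈c : b ≈ ⊤ → b ≈ c
    b≈⊤⇒b≈c b≈⊤ = antisym b≤c (trans (maximum c) (reflexive (Eq.sym b≈⊤)))

    c≈⊥⇒b≈c : c ≈ ⊥ → b ≈ c
    c≈⊥⇒b≈c c≈⊥ = antisym b≤c (trans (reflexive c≈⊥) (minimum b))

    x≈b⇒b≈c : x ≈ b → b ≈ c
    x≈b⇒b≈c x≈b =
      x≈⊥⇒b≈c (Eq.trans (Eq.sym (∧-idempotent x)) (Eq.trans (∧-cong Eq.refl x≈b) x∧b≈⊥))

    x≈c⇒b≈c : x ≈ c → b ≈ c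
    x≈c⇒b≈c x≈c =
      x≈⊥⇒b≈c (Eq.trans (Eq.sym (∧-idempotent x)) (Eq.trans (∧-cong Eq.refl x≈c) x∧c≈⊥))

    pentagon-injective : ¬ b ≈ c → ∀ p q → pentagon p ≈ pentagon q → p ≡ q
    pentagon-injective b≉c = injective
      where
      injective : ∀ p q → pentagon p ≈ pentagon q → p ≡ q
      injective n0 n0 _ = refl
      injective ne ne _ = refl
      injective nf nf _ = refl
      injective ng ng _ = refl
      injective n1 n1 _ = refl
      injective n0 ne e = ⊥-elim (b≉c (b≈⊥⇒b≈c (Eq.sym e)))
      injective ne n0 e = ⊥-elim (b≉c (b≈⊥⇒b≈c e))
      injective n0 nf e = ⊥-elim (b≉c (c≈⊥⇒b≈c (Eq.sym e)))
      injective nf n0 e = ⊥-elim (b≉c (c≈⊥⇒b≈c e))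
      injective n0 ng e = ⊥-elim (b≉c (x≈⊥⇒b≈c (Eq.sym e)))
      injective ng n0 e = ⊥-elim (b≉c (x≈⊥⇒b≈c e))
      injective n0 n1 e = ⊥-elim (b≉c (⊥≈⊤⇒b≈c e))
      injective n1 n0 e = ⊥-elim (b≉c (⊥≈⊤⇒b≈c (Eq.sym e)))
      injective ne nf e = ⊥-elim (b≉c e)
      injective nf ne e = ⊥-elim (b≉c (Eq.sym e))
      injective ne ng e = ⊥-elim (b≉c (x≈b⇒b≈c (Eq.sym e)))
      injective ng ne e = ⊥-elim (b≉c (x≈b⇒b≈c e))
      injective ne n1 e = ⊥-elim (b≉c (b≈⊤⇒b≈c e))
      injective n1 ne e = ⊥-elim (b≉c (b≈⊤⇒b≈c (Eq.sym e)))
      injective nf ng e = ⊥-elim (b≉c (x≈c⇒b≈c (Eq.sym e)))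
      injective ng nf e = ⊥-elim (b≉c (x≈c⇒b≈c e))
      injective nf n1 e = ⊥-elim (b≉c (c≈⊤⇒b≈c e))
      injective n1 nf e = ⊥-elim (b≉c (c≈⊤⇒b≈c (Eq.sym e)))
      injective ng n1 e = ⊥-elim (b≉c (x≈⊤⇒b≈c e))
      injective n1 ng e = ⊥-elim (b≉c (x≈⊤⇒b≈c (Eq.sym e)))

    pentagon-isN5Embedding : ¬ b ≈ c → IsN5Embedding pentagon
    pentagon-isN5Embedding b≉c =
      (λ p q → Eq.sym (pentagon-∨ p q)) ,
      (λ p q → Eq.sym (pentagon-∧ p q)) ,
      pentagon-injective b≉c

  comparableComplements⇒HasN5With01 : ∀ {x b c} →
    (x ⁺ᵉ) b → (x ⁺ᵉ) c → ¬ b ≈ c → b ≤ c → HasN5With01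
  comparableComplements⇒HasN5With01 {x} b∈x⁺ c∈x⁺ b≉c b≤c =
    pentagon , pentagon-isN5Embedding b≉c , (n0 , Eq.refl) , (n1 , Eq.refl)
    where open Pentagon (proj₁ (b∈x⁺ x Eq.refl)) (proj₂ (c∈x⁺ x Eq.refl)) b≤c

  ¬HasN5With01⇒antichain : ¬ HasN5With01 → ∀ x → Antichain (x ⁺ᵉ)
  ¬HasN5With01⇒antichain noN5 x b c b∈x⁺ c∈x⁺ b≉c b≤c =
    noN5 (comparableComplements⇒HasN5With01 b∈x⁺ c∈x⁺ b≉c b≤c)

proposition2p3 : {c ℓ₁ ℓ₂ : Level} (L : BoundedLattice c ℓ₁ ℓ₂) →
    let open BoundedLattice L
        open Ops L
    in ¬ (⊥ ≈ ⊤) → Complemented →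
       (∀ a → ((a ⁺ᵉ) ⁺) a × (((a ⁺ᵉ) ⁺) ⁺) ≐ (a ⁺ᵉ)) ×
       ((∀ x → Antichain (x ⁺ᵉ)) ⇔ (¬ HasN5With01)) ×
       (∀ a → Convex (a ⁺ᵉ)) ×
       (¬ PlusPlusInjective → ¬ SatisfiesPlusPlusId)
proposition2p3 L _ _ =
  (λ a → ⊆⁺⁺ (Eq.refl {a}) , ⁺⁺⁺≐⁺ ｛ a ｝) ,
  mk⇔ antichain⇒¬HasN5With01 ¬HasN5With01⇒antichain ,
  ⁺ᵉ-convex ,
  λ notInjective plusPlusId → notInjective (plusPlusId⇒plusPlusInjective plusPlusId)
  where
  open BoundedLattice L using (module Eq)
  open Ops L using (｛_｝)
  open Complements L
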